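{- The graph $H^{2,l_y,l_z}$ belongs to $\textsc{And}(1)$ for all integers $l_y,l_z\ge 2$, and the graph $H^{3,l_y,l_z}$ belongs to $\textsc{And}(1)$ for all integers $l_y,l_z\ge 3$.
   Context: All graphs are finite, simple and connected. For integers $l_x,l_y,l_z\ge 2$, $H^{l_x,l_y,l_z}$ is the graph consisting of two non-adjacent vertices $a,b$ together with three internally vertex-disjoint paths from $a$ to $b$, namely $X=(a=x_0,x_1,\dots,x_{l_x}=b)$, $Y=(a=y_0,y_1,\dots,y_{l_y}=b)$, $Z=(a=z_0,z_1,\dots,z_{l_z}=b)$, of edge-lengths $l_x,l_y,l_z$ respectively, and no other vertices or edges. An $\textsc{And}(1)$-realization of a graph $G=(V,E)$ is a family $\{([L(v),R(v)],p_v):v\in V\}$ of closed real intervals and points $p_v\in[L(v),R(v)]$ such that for distinct $u,v$: $uv\in E$ iff $p_v\in[L(u),R(u)]$ and $p_u\in[L(v),R(v)]$. $\textsc{And}(1)$ is the class of graphs admitting an $\textsc{And}(1)$-realization. -}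

module Defs where

open import Data.Nat using (ℕ; zero; suc; _∸_; _<_; _<?_)
open import Data.Fin using (Fin; fromℕ<)
open import Data.Product using (Σ; _×_)
open import Data.Sum using (_⊎_)
open import Relation.Nullary using (¬_; yes; no)
open import Relation.Binary.PropositionalEquality using (_≡_)
open import Data.Rational using (ℚ; _≤_)

-- Vertex set of H^{lx,ly,lz}: the two ends a, b and the internal
-- vertices of the three paths.  (hx i) is x_{i+1}, for i = 0 .. lx-2,
-- and similarly for Y and Z.
data HV (lx ly lz : ℕ) : Set where
  ha hb : HV lx ly lz
  hx : Fin (lx ∸ 1) → HV lx ly lz
  hy : Fin (ly ∸ 1) → HV lx ly lz
  hz : Fin (lz ∸ 1) → HV lx ly lz

pathVertex : {V : Set} → V → V → (l : ℕ) → (Fin (l ∸ 1) → V) → ℕ → V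
pathVertex a b l f zero = a
pathVertex a b l f (suc k) with k <? l ∸ 1
... | yes p = f (fromℕ< p)
... | no _  = b

PathEdge : {V : Set} → V → V → (l : ℕ) → (Fin (l ∸ 1) → V) → V → V → Set
PathEdge a b l f u v =
  Σ ℕ (λ k → k < l × (u ≡ pathVertex a b l f k × v ≡ pathVertex a b l f (suc k)))

HAdj : (lx ly lz : ℕ) → HV lx ly lz → HV lx ly lz → Set
HAdj lx ly lz u v =
  (PathEdge ha hb lx hx u v ⊎ PathEdge ha hb lx hx v u) ⊎
  ((PathEdge ha hb ly hy u v ⊎ PathEdge ha hb ly hy v u) ⊎
   (PathEdge ha hb lz hz u v ⊎ PathEdge ha hb lz hz v u))

record And1Realization {V : Set} (E : V → V → Set) : Set where
  field
    L R p : V → ℚ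
    p∈ : ∀ v → L v ≤ p v × p v ≤ R v
    adj⇒ : ∀ u v → ¬ (u ≡ v) → E u v →
      (L u ≤ p v × p v ≤ R u) × (L v ≤ p u × p u ≤ R v)
    ⇒adj : ∀ u v → ¬ (u ≡ v) →
      (L u ≤ p v × p v ≤ R u) × (L v ≤ p u × p u ≤ R v) → E u v

InAnd1 : {V : Set} → (V → V → Set) → Set
InAnd1 E = And1Realization E

-- The paths Y and Z form a cycle. Cut it open at one edge and lay it out on the even points
-- 0, 2, …, 2t of a line: every vertex gets the interval reaching exactly to the points of its
-- two neighbours on the line, except the two ends of the line, whose intervals cover everything.
-- Two cycle vertices then contain each other's points exactly when they are adjacent on the
-- cycle. The inner vertices of X sit on odd points right next to a or b. Such a point lies only
-- in the intervals of its two neighbours on the line and of the two long ends, and the intervals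
-- of X, which run from a (or just before it) to just after b, miss the points of all of these
-- except a and b.
module Submission where

open import Defs
open import Data.Bool using (T)
open import Data.Empty using (⊥-elim)
open import Data.Fin using (Fin; zero; suc; toℕ; fromℕ<)
open import Data.Fin.Properties
  using (toℕ<n; toℕ≤pred[n]; toℕ-fromℕ<; fromℕ<-toℕ; toℕ-injective)
import Data.Integer as ℤ
import Data.Integer.Properties as ℤ
open import Data.Nat using (ℕ; zero; suc; _+_; _*_; _∸_; _≤_; _<_; _<?_; _≤ᵇ_; z≤n; s≤s)
open import Data.Nat.Properties
open import Data.Product using (Σ-syntax; _×_; _,_; proj₁; proj₂)
open import Data.Rational using (ℚ; *≤*) renaming (_≤_ to _≤ℚ_)
open import Data.Rational.Literals using (fromℤ)
open import Data.Sum using (_⊎_; inj₁; inj₂; [_,_])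
open import Function using (_∘_)
open import Relation.Nullary using (yes; no)
open import Relation.Binary.Definitions using (tri<; tri≈; tri>)
open import Relation.Binary.PropositionalEquality
  using (_≡_; _≢_; refl; sym; trans; cong; subst; subst₂; module ≡-Reasoning)

-- Paths and the edges of H

data PathAdj {V : Set} (a b : V) (n : ℕ) (f : Fin (suc n) → V) : V → V → Set where
  start  : ∀ {i} → toℕ i ≡ 0 → PathAdj a b n f a (f i)
  step   : ∀ {i j} → toℕ j ≡ suc (toℕ i) → PathAdj a b n f (f i) (f j)
  finish : ∀ {i} → toℕ i ≡ n → PathAdj a b n f (f i) b

module _ {V : Set} {a b : V} {n : ℕ} {f : Fin (suc n) → V} where

  private
    vertex : ℕ → V
    vertex = pathVertex a b (suc (suc n)) f

  pathVertex-suc : ∀ k → k ≤ suc n →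
    (Σ[ i ∈ Fin (suc n) ] toℕ i ≡ k × vertex (suc k) ≡ f i) ⊎ (k ≡ suc n × vertex (suc k) ≡ b)
  pathVertex-suc k k≤1+n with k <? suc n
  ... | yes k<1+n = inj₁ (fromℕ< k<1+n , toℕ-fromℕ< k<1+n , refl)
  ... | no k≮1+n = inj₂ (≤-antisym k≤1+n (≮⇒≥ k≮1+n) , refl)

  pathVertex-at : ∀ {i k} → toℕ i ≡ k → vertex (suc k) ≡ f i
  pathVertex-at {i} refl with toℕ i <? suc n
  ... | yes i<1+n = cong f (fromℕ<-toℕ i i<1+n)
  ... | no i≮1+n = ⊥-elim (i≮1+n (toℕ<n i))

  pathVertex-end : vertex (suc (suc n)) ≡ b
  pathVertex-end with suc n <? suc n
  ... | yes n<n = ⊥-elim (<-irrefl refl n<n)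
  ... | no _ = refl

  PathEdge⇒PathAdj : ∀ {u v} → PathEdge a b (suc (suc n)) f u v → PathAdj a b n f u v
  PathEdge⇒PathAdj (zero , _ , refl , refl) = start refl
  PathEdge⇒PathAdj (suc k , s≤s k<1+n , refl , refl)
    with pathVertex-suc k (<⇒≤ k<1+n) | pathVertex-suc (suc k) k<1+n
  ... | inj₁ (i , refl , u≡) | inj₁ (j , j≡1+i , v≡) =
    subst₂ (PathAdj a b n f) (sym u≡) (sym v≡) (step j≡1+i)
  ... | inj₁ (i , refl , u≡) | inj₂ (1+i≡1+n , v≡) =
    subst₂ (PathAdj a b n f) (sym u≡) (sym v≡) (finish (suc-injective 1+i≡1+n))
  ... | inj₂ (refl , _) | _ = ⊥-elim (<-irrefl refl k<1+n)

  PathAdj⇒PathEdge : ∀ {u v} → PathAdj a b n f u v → PathEdge a b (suc (suc n)) f u v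
  PathAdj⇒PathEdge (start i≡0) = zero , s≤s z≤n , refl , sym (pathVertex-at i≡0)
  PathAdj⇒PathEdge (step {i} j≡1+i) =
    suc (toℕ i) , s≤s (toℕ<n i) , sym (pathVertex-at refl) , sym (pathVertex-at j≡1+i)
  PathAdj⇒PathEdge (finish i≡n) =
    suc n , ≤-refl , sym (pathVertex-at i≡n) , sym pathVertex-end

module _ {p q r : ℕ} where

  private
    V : Set
    V = HV (suc (suc p)) (suc (suc q)) (suc (suc r))

    H : V → V → Set
    H = HAdj (suc (suc p)) (suc (suc q)) (suc (suc r))

  HAdj-sym : ∀ {u v} → H u v → H v u
  HAdj-sym = [ [ inj₁ ∘ inj₂ , inj₁ ∘ inj₁ ] ,
               [ [ inj₂ ∘ inj₁ ∘ inj₂ , inj₂ ∘ inj₁ ∘ inj₁ ] ,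
                 [ inj₂ ∘ inj₂ ∘ inj₂ , inj₂ ∘ inj₂ ∘ inj₁ ] ] ]

  x-edge : ∀ {u v} → PathAdj ha hb p hx u v → H u v
  x-edge = inj₁ ∘ inj₁ ∘ PathAdj⇒PathEdge

  y-edge : ∀ {u v} → PathAdj ha hb q hy u v → H u v
  y-edge = inj₂ ∘ inj₁ ∘ inj₁ ∘ PathAdj⇒PathEdge

  z-edge : ∀ {u v} → PathAdj ha hb r hz u v → H u v
  z-edge = inj₂ ∘ inj₂ ∘ inj₁ ∘ PathAdj⇒PathEdge

  HAdj-rec : ∀ {C : V → V → Set} → (∀ {u v} → C u v → C v u) →
    (∀ {u v} → PathAdj ha hb p hx u v → C u v) →
    (∀ {u v} → PathAdj ha hb q hy u v → C u v) →
    (∀ {u v} → PathAdj ha hb r hz u v → C u v) →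
    ∀ {u v} → H u v → C u v
  HAdj-rec {C} C-sym cx cy cz = [ both cx , [ both cy , both cz ] ]
    where
    both : ∀ {l f} → (∀ {u v} → PathAdj ha hb l f u v → C u v) → ∀ {u v} →
      PathEdge ha hb (suc (suc l)) f u v ⊎ PathEdge ha hb (suc (suc l)) f v u → C u v
    both c = [ (λ e → c (PathEdge⇒PathAdj e)) , (λ e → C-sym (c (PathEdge⇒PathAdj e))) ]

backIndex : ∀ {n} → Fin (suc n) → ℕ
backIndex {n} i = n ∸ toℕ i

module _ {n : ℕ} where

  backIndex+toℕ : ∀ (i : Fin (suc n)) → backIndex i + toℕ i ≡ n
  backIndex+toℕ i = m∸n+n≡m (toℕ≤pred[n] i)

  backIndex-step : ∀ {i j : Fin (suc n)} → toℕ j ≡ suc (toℕ i) → backIndex i ≡ suc (backIndex j)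
  backIndex-step {i} {j} j≡1+i = +-cancelʳ-≡ (toℕ i) _ _ (begin
    backIndex i + toℕ i        ≡⟨ backIndex+toℕ i ⟩
    n                          ≡⟨ sym (backIndex+toℕ j) ⟩
    backIndex j + toℕ j        ≡⟨ cong (backIndex j +_) j≡1+i ⟩
    backIndex j + suc (toℕ i)  ≡⟨ +-suc (backIndex j) (toℕ i) ⟩
    suc (backIndex j) + toℕ i  ∎)
    where open ≡-Reasoning

  backIndex-step⁻¹ : ∀ {i j : Fin (suc n)} → backIndex i ≡ suc (backIndex j) → toℕ j ≡ suc (toℕ i)
  backIndex-step⁻¹ {i} {j} i≡1+j = +-cancelˡ-≡ (backIndex j) _ _ (begin
    backIndex j + toℕ j        ≡⟨ backIndex+toℕ j ⟩
    n                          ≡⟨ sym (backIndex+toℕ i) ⟩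
    backIndex i + toℕ i        ≡⟨ cong (_+ toℕ i) i≡1+j ⟩
    suc (backIndex j) + toℕ i  ≡⟨ sym (+-suc (backIndex j) (toℕ i)) ⟩
    backIndex j + suc (toℕ i)  ∎)
    where open ≡-Reasoning

  backIndex-injective : ∀ {i j : Fin (suc n)} → backIndex i ≡ backIndex j → i ≡ j
  backIndex-injective {i} {j} i≡j = toℕ-injective (+-cancelˡ-≡ (backIndex i) _ _ (begin
    backIndex i + toℕ i  ≡⟨ backIndex+toℕ i ⟩
    n                    ≡⟨ sym (backIndex+toℕ j) ⟩
    backIndex j + toℕ j  ≡⟨ cong (_+ toℕ j) (sym i≡j) ⟩
    backIndex i + toℕ j  ∎))
    where open ≡-Reasoning

  backIndex≡0 : ∀ {i : Fin (suc n)} → toℕ i ≡ n → backIndex i ≡ 0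
  backIndex≡0 i≡n = trans (cong (n ∸_) i≡n) (n∸n≡0 n)

  backIndex≡0⁻¹ : ∀ {i : Fin (suc n)} → backIndex i ≡ 0 → toℕ i ≡ n
  backIndex≡0⁻¹ {i} i≡0 = trans (sym (cong (_+ toℕ i) i≡0)) (backIndex+toℕ i)

  toℕ≤-from-backIndex : ∀ {k} (i : Fin (suc n)) → n ≤ k + backIndex i → toℕ i ≤ k
  toℕ≤-from-backIndex {k} i n≤k+i = +-cancelʳ-≤ (backIndex i) (toℕ i) k
    (subst (_≤ k + backIndex i)
      (trans (sym (backIndex+toℕ i)) (+-comm (backIndex i) (toℕ i))) n≤k+i)

-- Realizations with natural-number coordinates

record Pointed : Set where
  constructor ⟨_,_,_⟩
  field lo pt hi : ℕ

open Pointed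

infix 4 _∋_

_∋_ : Pointed → ℕ → Set
I ∋ x = lo I ≤ x × x ≤ hi I

Sees : Pointed → Pointed → Set
Sees I J = I ∋ pt J

Mutual : Pointed → Pointed → Set
Mutual I J = Sees I J × Sees J I

Mutual-sym : ∀ {I J} → Mutual I J → Mutual J I
Mutual-sym (I→J , J→I) = J→I , I→J

record And1Realizationℕ {V : Set} (E : V → V → Set) : Set where
  field
    shape       : V → Pointed
    pt∈shape    : ∀ v → Sees (shape v) (shape v)
    edge⇒mutual : ∀ {u v} → E u v → Mutual (shape u) (shape v)
    mutual⇒edge : ∀ {u v} → u ≢ v → Mutual (shape u) (shape v) → E u v

ℕ→ℚ : ℕ → ℚ
ℕ→ℚ n = fromℤ (ℤ.+ n)

ℕ→ℚ-mono-≤ : ∀ {m n} → m ≤ n → ℕ→ℚ m ≤ℚ ℕ→ℚ n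
ℕ→ℚ-mono-≤ m≤n =
  *≤* (subst₂ ℤ._≤_ (sym (ℤ.*-identityʳ _)) (sym (ℤ.*-identityʳ _)) (ℤ.+≤+ m≤n))

ℕ→ℚ-cancel-≤ : ∀ {m n} → ℕ→ℚ m ≤ℚ ℕ→ℚ n → m ≤ n
ℕ→ℚ-cancel-≤ (*≤* m≤n) =
  ℤ.drop‿+≤+ (subst₂ ℤ._≤_ (ℤ.*-identityʳ _) (ℤ.*-identityʳ _) m≤n)

And1Realizationℕ⇒InAnd1 : ∀ {V : Set} {E : V → V → Set} → And1Realizationℕ E → InAnd1 E
And1Realizationℕ⇒InAnd1 ρ = record
  { L = ℕ→ℚ ∘ lo ∘ shape
  ; R = ℕ→ℚ ∘ hi ∘ shape
  ; p = ℕ→ℚ ∘ pt ∘ shape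
  ; p∈ = λ v → embed (shape v) (shape v) (pt∈shape v)
  ; adj⇒ = λ u v _ e → let (u→v , v→u) = edge⇒mutual e in
      embed (shape u) (shape v) u→v , embed (shape v) (shape u) v→u
  ; ⇒adj = λ u v u≢v (u→v , v→u) →
      mutual⇒edge u≢v (cancel (shape u) (shape v) u→v , cancel (shape v) (shape u) v→u)
  }
  where
  open And1Realizationℕ ρ

  Seesℚ : Pointed → Pointed → Set
  Seesℚ I J = ℕ→ℚ (lo I) ≤ℚ ℕ→ℚ (pt J) × ℕ→ℚ (pt J) ≤ℚ ℕ→ℚ (hi I)

  embed : ∀ I J → Sees I J → Seesℚ I J
  embed _ _ (lo≤x , x≤hi) = ℕ→ℚ-mono-≤ lo≤x , ℕ→ℚ-mono-≤ x≤hi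

  cancel : ∀ I J → Seesℚ I J → Sees I J
  cancel _ _ (lo≤x , x≤hi) = ℕ→ℚ-cancel-≤ lo≤x , ℕ→ℚ-cancel-≤ x≤hi

mutual⇒edge-by-rank : ∀ {V : Set} {E : V → V → Set} (shape : V → Pointed) (rank : V → ℕ) →
  (∀ {u v} → E u v → E v u) →
  (∀ u v → T (rank u ≤ᵇ rank v) → u ≢ v → Mutual (shape u) (shape v) → E u v) →
  ∀ {u v} → u ≢ v → Mutual (shape u) (shape v) → E u v
mutual⇒edge-by-rank shape rank E-sym ordered {u} {v} u≢v m with ≤-total (rank u) (rank v)
... | inj₁ u≤v = ordered u v (≤⇒≤ᵇ u≤v) u≢v m
... | inj₂ v≤u = E-sym (ordered v u (≤⇒≤ᵇ v≤u) (u≢v ∘ sym) (Mutual-sym m))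

-- Cycles on the even points of a line

-- A vertex in slot s of the line has its point at 2s; `first t` and `last t` are the two ends
-- of a line with slots 0, …, t, and `short k` is the vertex in slot k + 1.
first last : ℕ → Pointed
first t = ⟨ 0 , 0 , 2 * t ⟩
last t = ⟨ 0 , 2 * t , 2 * t ⟩

short : ℕ → Pointed
short k = ⟨ 2 * k , 2 * suc k , 2 * suc (suc k) ⟩

2*m≤1+2*n⇒m≤n : ∀ {m n} → 2 * m ≤ suc (2 * n) → m ≤ n
2*m≤1+2*n⇒m≤n {m} {n} 2m≤1+2n =
  ≤-pred (*-cancelˡ-< 2 m (suc n) (subst (2 * m <_) (sym (*-suc 2 n)) (s≤s 2m≤1+2n)))

short∋even : ∀ {k m} → short k ∋ 2 * m → k ≤ m × m ≤ 2 + k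
short∋even (2k≤2m , 2m≤2k+4) = *-cancelˡ-≤ 2 2k≤2m , *-cancelˡ-≤ 2 2m≤2k+4

short∋0 : ∀ {k} → short k ∋ 0 → k ≡ 0
short∋0 k→0 = n≤0⇒n≡0 (proj₁ (short∋even {m = 0} k→0))

short∋odd : ∀ {k m} → short k ∋ suc (2 * m) → k ≤ m × m ≤ suc k
short∋odd {k} {m} (2k≤2m+1 , 2m+1≤2k+4) =
  2*m≤1+2*n⇒m≤n 2k≤2m+1 , ≤-pred (*-cancelˡ-< 2 m (2 + k) 2m+1≤2k+4)

even∈short : ∀ {k m} → k ≤ m → m ≤ 2 + k → short k ∋ 2 * m
even∈short k≤m m≤2+k = *-monoʳ-≤ 2 k≤m , *-monoʳ-≤ 2 m≤2+k

odd∈short : ∀ {k m} → k ≤ m → m ≤ suc k → short k ∋ suc (2 * m)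
odd∈short k≤m m≤1+k = ≤-trans (*-monoʳ-≤ 2 k≤m) (n≤1+n _) , *-monoʳ-< 2 (s≤s m≤1+k)

short-self : ∀ k → Sees (short k) (short k)
short-self k = even∈short (n≤1+n k) (m≤n+m (suc k) 1)

short-mutual : ∀ k {l} → suc k ≡ l → Mutual (short k) (short l)
short-mutual k refl = even∈short (m≤n+m k 2) ≤-refl , even∈short ≤-refl (m≤n+m (suc k) 2)

short-mutual⇒adjacent : ∀ {k l} → k ≢ l → Mutual (short k) (short l) → suc k ≡ l ⊎ suc l ≡ k
short-mutual⇒adjacent {k} {l} k≢l (k→l , _) with short∋even k→l | <-cmp k l
... | _ , 1+l≤2+k | tri< k<l _ _ = inj₁ (≤-antisym k<l (≤-pred 1+l≤2+k))
... | _ | tri≈ _ k≡l _ = ⊥-elim (k≢l k≡l)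
... | k≤1+l , _ | tri> _ _ l<k = inj₂ (≤-antisym l<k k≤1+l)

first-mutual-short : ∀ {t} → 1 ≤ t → Mutual (first t) (short 0)
first-mutual-short 1≤t = (z≤n , *-monoʳ-≤ 2 1≤t) , (z≤n , z≤n)

short-mutual-last : ∀ {k t} → suc (suc k) ≡ t → Mutual (short k) (last t)
short-mutual-last {k} refl = even∈short (m≤n+m k 2) ≤-refl , (z≤n , *-monoʳ-≤ 2 (n≤1+n (suc k)))

first-mutual-last : ∀ {t} → Mutual (first t) (last t)
first-mutual-last = (z≤n , ≤-refl) , (z≤n , z≤n)

-- Inner vertices of a path laid out backwards: f i in slot backIndex i + c + 1.
reversed-mutual : ∀ {n} c {i j : Fin (suc n)} → toℕ j ≡ suc (toℕ i) →
  Mutual (short (backIndex i + c)) (short (backIndex j + c))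
reversed-mutual c {j = j} j≡1+i =
  Mutual-sym (short-mutual (backIndex j + c) (cong (_+ c) (sym (backIndex-step j≡1+i))))

reversed-mutual⇒adjacent : ∀ {n} c {i j : Fin (suc n)} → i ≢ j →
  Mutual (short (backIndex i + c)) (short (backIndex j + c)) →
  toℕ j ≡ suc (toℕ i) ⊎ toℕ i ≡ suc (toℕ j)
reversed-mutual⇒adjacent c i≢j m
  with short-mutual⇒adjacent (i≢j ∘ backIndex-injective ∘ +-cancelʳ-≡ c _ _) m
... | inj₁ 1+i≡j = inj₂ (backIndex-step⁻¹ (sym (+-cancelʳ-≡ c _ _ 1+i≡j)))
... | inj₂ 1+j≡i = inj₁ (backIndex-step⁻¹ (sym (+-cancelʳ-≡ c _ _ 1+j≡i)))

-- Line: a, y₁, …, y_{l_y−1}, b, z_{l_z−1}, …, z₁, in slots 0, …, end-slot; x is just right of b.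
module H₂ (q r : ℕ) where

  V : Set
  V = HV 2 (2 + q) (2 + r)

  E : V → V → Set
  E = HAdj 2 (2 + q) (2 + r)

  b-slot end-slot after-b : ℕ
  b-slot = 2 + q
  end-slot = suc (r + b-slot)
  after-b = suc (2 * b-slot)

  shape : V → Pointed
  shape ha = first end-slot
  shape (hy i) = short (toℕ i)
  shape hb = short (suc q)
  shape (hz zero) = last end-slot
  shape (hz (suc i)) = short (backIndex (suc i) + b-slot)
  shape (hx _) = ⟨ 0 , after-b , after-b ⟩

  b-slot<end-slot : b-slot < end-slot
  b-slot<end-slot = s≤s (m≤n+m b-slot r)

  pt∈shape : ∀ v → Sees (shape v) (shape v)
  pt∈shape ha = z≤n , z≤n
  pt∈shape (hy i) = short-self (toℕ i)
  pt∈shape hb = short-self (suc q)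
  pt∈shape (hz zero) = z≤n , ≤-refl
  pt∈shape (hz (suc i)) = short-self (backIndex (suc i) + b-slot)
  pt∈shape (hx _) = z≤n , ≤-refl

  x-mutual : ∀ {u v} → PathAdj ha hb 0 hx u v → Mutual (shape u) (shape v)
  x-mutual (start {zero} _) = (z≤n , *-monoʳ-< 2 b-slot<end-slot) , (z≤n , z≤n)
  x-mutual (step {zero} {zero} ())
  x-mutual (finish {zero} _) = (z≤n , n≤1+n _) , odd∈short (n≤1+n (suc q)) ≤-refl

  y-mutual : ∀ {u v} → PathAdj ha hb q hy u v → Mutual (shape u) (shape v)
  y-mutual (start i≡0) rewrite i≡0 = first-mutual-short (s≤s z≤n)
  y-mutual (step {i} j≡1+i) = short-mutual (toℕ i) (sym j≡1+i)
  y-mutual (finish {i} i≡q) = short-mutual (toℕ i) (cong suc i≡q)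

  z-mutual : ∀ {u v} → PathAdj ha hb r hz u v → Mutual (shape u) (shape v)
  z-mutual (start {zero} _) = first-mutual-last {end-slot}
  z-mutual (step {zero} {suc _} j≡1) =
    Mutual-sym (short-mutual-last (cong (λ t → suc (t + b-slot)) (sym (backIndex-step j≡1))))
  z-mutual (step {suc _} {suc _} j≡1+i) = reversed-mutual b-slot j≡1+i
  z-mutual (finish {zero} 0≡r) = Mutual-sym (short-mutual-last (cong (λ t → suc (t + b-slot)) 0≡r))
  z-mutual (finish {suc i} i≡r) =
    Mutual-sym (short-mutual (suc q) (cong (_+ b-slot) (sym (backIndex≡0 i≡r))))

  z-mutual⇒edge : ∀ i j → _≢_ {A = V} (hz i) (hz j) → Mutual (shape (hz i)) (shape (hz j)) →
    E (hz i) (hz j)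
  z-mutual⇒edge zero zero 0≢0 _ = ⊥-elim (0≢0 refl)
  z-mutual⇒edge zero (suc j) _ (_ , j→0) =
    z-edge (step (cong suc (n≤0⇒n≡0 (≤-pred (toℕ≤-from-backIndex (suc j) r≤1+j)))))
    where
    r≤1+j : r ≤ 1 + backIndex (suc j)
    r≤1+j = ≤-pred (+-cancelʳ-≤ b-slot (suc r) _ (proj₂ (short∋even j→0)))
  z-mutual⇒edge (suc i) zero i≢0 m =
    HAdj-sym (z-mutual⇒edge zero (suc i) (λ 0≡i → i≢0 (sym 0≡i)) (Mutual-sym m))
  z-mutual⇒edge (suc i) (suc j) i≢j m
    with reversed-mutual⇒adjacent b-slot (λ i≡j → i≢j (cong hz i≡j)) m
  ... | inj₁ j≡1+i = z-edge (step j≡1+i)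
  ... | inj₂ i≡1+j = HAdj-sym (z-edge (step i≡1+j))

  rank : V → ℕ
  rank ha = 0
  rank hb = 1
  rank (hx _) = 2
  rank (hy _) = 3
  rank (hz _) = 4

  ordered-mutual⇒edge : ∀ u v → T (rank u ≤ᵇ rank v) → u ≢ v → Mutual (shape u) (shape v) → E u v
  ordered-mutual⇒edge ha ha _ a≢a _ = ⊥-elim (a≢a refl)
  ordered-mutual⇒edge ha hb _ _ (_ , b→a) = ⊥-elim (1+n≢0 (short∋0 b→a))
  ordered-mutual⇒edge ha (hx zero) _ _ _ = x-edge (start refl)
  ordered-mutual⇒edge ha (hy i) _ _ (_ , y→a) = y-edge (start (short∋0 y→a))
  ordered-mutual⇒edge ha (hz zero) _ _ _ = z-edge (start refl)
  ordered-mutual⇒edge ha (hz (suc j)) _ _ (_ , z→a) = ⊥-elim (m+1+n≢0 _ (short∋0 z→a))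
  ordered-mutual⇒edge hb hb _ b≢b _ = ⊥-elim (b≢b refl)
  ordered-mutual⇒edge hb (hx zero) _ _ _ = HAdj-sym (x-edge (finish refl))
  ordered-mutual⇒edge hb (hy i) _ _ (b→y , _) =
    HAdj-sym (y-edge (finish (≤-antisym (toℕ≤pred[n] i) (≤-pred (proj₁ (short∋even b→y))))))
  ordered-mutual⇒edge hb (hz zero) _ _ (b→z , _) =
    HAdj-sym (z-edge (finish (sym (n≤0⇒n≡0
      (+-cancelʳ-≤ b-slot r 0 (≤-pred (proj₂ (short∋even b→z))))))))
  ordered-mutual⇒edge hb (hz (suc j)) _ _ (b→z , _) =
    HAdj-sym (z-edge (finish (backIndex≡0⁻¹ (n≤0⇒n≡0
      (+-cancelʳ-≤ b-slot _ 0 (≤-pred (proj₂ (short∋even b→z))))))))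
  ordered-mutual⇒edge (hx zero) (hx zero) _ x≢x _ = ⊥-elim (x≢x refl)
  ordered-mutual⇒edge (hx _) (hy i) _ _ (_ , y→x) =
    ⊥-elim (<⇒≱ (≤-pred (proj₂ (short∋odd y→x))) (toℕ≤pred[n] i))
  ordered-mutual⇒edge (hx _) (hz zero) _ _ ((_ , x→z) , _) =
    ⊥-elim (<⇒≱ b-slot<end-slot (2*m≤1+2*n⇒m≤n x→z))
  ordered-mutual⇒edge (hx _) (hz (suc j)) _ _ ((_ , x→z) , _) =
    ⊥-elim (<⇒≱ (s≤s (m≤n+m b-slot _)) (2*m≤1+2*n⇒m≤n x→z))
  ordered-mutual⇒edge (hy i) (hy j) _ i≢j m
    with short-mutual⇒adjacent (λ i≡j → i≢j (cong hy (toℕ-injective i≡j))) m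
  ... | inj₁ 1+i≡j = y-edge (step (sym 1+i≡j))
  ... | inj₂ 1+j≡i = HAdj-sym (y-edge (step (sym 1+j≡i)))
  ordered-mutual⇒edge (hy i) (hz zero) _ _ (y→z , _) =
    ⊥-elim (<⇒≱ b-slot<end-slot (≤-trans (proj₂ (short∋even y→z)) (s≤s (s≤s (toℕ≤pred[n] i)))))
  ordered-mutual⇒edge (hy i) (hz (suc j)) _ _ (y→z , _) =
    ⊥-elim (<⇒≱ (s≤s (m≤n+m b-slot _))
      (≤-trans (proj₂ (short∋even y→z)) (s≤s (s≤s (toℕ≤pred[n] i)))))
  ordered-mutual⇒edge (hz i) (hz j) _ i≢j m = z-mutual⇒edge i j i≢j m
  ordered-mutual⇒edge hb ha () _ _
  ordered-mutual⇒edge (hx _) ha () _ _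
  ordered-mutual⇒edge (hx _) hb () _ _
  ordered-mutual⇒edge (hy _) ha () _ _
  ordered-mutual⇒edge (hy _) hb () _ _
  ordered-mutual⇒edge (hy _) (hx _) () _ _
  ordered-mutual⇒edge (hz _) ha () _ _
  ordered-mutual⇒edge (hz _) hb () _ _
  ordered-mutual⇒edge (hz _) (hx _) () _ _
  ordered-mutual⇒edge (hz _) (hy _) () _ _

  realization : And1Realizationℕ E
  realization = record
    { shape = shape
    ; pt∈shape = pt∈shape
    ; edge⇒mutual = HAdj-rec Mutual-sym x-mutual y-mutual z-mutual
    ; mutual⇒edge = mutual⇒edge-by-rank shape rank HAdj-sym ordered-mutual⇒edge
    }

-- Line: z₁, a, y₁, …, y_{l_y−1}, b, z_{l_z−1}, …, z₂, in slots 0, …, end-slot; x₁ is just left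
-- of a and x₂ just right of b. Cutting the cycle at z₁z₂ rather than at a or b is what needs
-- l_z ≥ 3.
module H₃ (q r : ℕ) where

  V : Set
  V = HV 3 (2 + q) (3 + r)

  E : V → V → Set
  E = HAdj 3 (2 + q) (3 + r)

  b-slot end-slot after-b : ℕ
  b-slot = 3 + q
  end-slot = suc (r + b-slot)
  after-b = suc (2 * b-slot)

  xPoint : Fin 2 → ℕ
  xPoint zero = 1
  xPoint (suc zero) = after-b

  shape : V → Pointed
  shape (hz zero) = first end-slot
  shape ha = short 0
  shape (hy i) = short (suc (toℕ i))
  shape hb = short (2 + q)
  shape (hz (suc zero)) = last end-slot
  shape (hz (suc (suc k))) = short (backIndex (suc (suc k)) + b-slot)
  shape (hx i) = ⟨ 1 , xPoint i , after-b ⟩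

  b-slot<end-slot : b-slot < end-slot
  b-slot<end-slot = s≤s (m≤n+m b-slot r)

  1≤after-b : 1 ≤ after-b
  1≤after-b = s≤s z≤n

  pt∈shape : ∀ v → Sees (shape v) (shape v)
  pt∈shape (hz zero) = z≤n , z≤n
  pt∈shape ha = short-self 0
  pt∈shape (hy i) = short-self (suc (toℕ i))
  pt∈shape hb = short-self (2 + q)
  pt∈shape (hz (suc zero)) = z≤n , ≤-refl
  pt∈shape (hz (suc (suc k))) = short-self (backIndex (suc (suc k)) + b-slot)
  pt∈shape (hx zero) = ≤-refl , 1≤after-b
  pt∈shape (hx (suc zero)) = 1≤after-b , ≤-refl

  x-mutual : ∀ {u v} → PathAdj ha hb 1 hx u v → Mutual (shape u) (shape v)
  x-mutual (start {zero} _) =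
    (z≤n , s≤s z≤n) , (s≤s z≤n , ≤-trans (*-monoʳ-≤ 2 {1} {b-slot} (s≤s z≤n)) (n≤1+n (2 * b-slot)))
  x-mutual (step {zero} {suc zero} _) = (1≤after-b , ≤-refl) , (≤-refl , 1≤after-b)
  x-mutual (finish {suc zero} _) =
    (s≤s z≤n , n≤1+n (2 * b-slot)) , odd∈short (n≤1+n (2 + q)) ≤-refl
  x-mutual (step {zero} {zero} ())
  x-mutual (step {suc zero} {zero} ())
  x-mutual (step {suc zero} {suc zero} ())
  x-mutual (finish {zero} ())

  y-mutual : ∀ {u v} → PathAdj ha hb q hy u v → Mutual (shape u) (shape v)
  y-mutual (start i≡0) = short-mutual 0 (cong suc (sym i≡0))
  y-mutual (step {i} j≡1+i) = short-mutual (suc (toℕ i)) (cong suc (sym j≡1+i))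
  y-mutual (finish {i} i≡q) = short-mutual (suc (toℕ i)) (cong (λ t → suc (suc t)) i≡q)

  z-mutual : ∀ {u v} → PathAdj ha hb (suc r) hz u v → Mutual (shape u) (shape v)
  z-mutual (start {zero} _) = Mutual-sym (first-mutual-short (s≤s z≤n))
  z-mutual (step {zero} {suc zero} _) = first-mutual-last {end-slot}
  z-mutual (step {suc zero} {suc (suc _)} k≡2) =
    Mutual-sym (short-mutual-last (cong (λ t → suc (t + b-slot)) (sym (backIndex-step k≡2))))
  z-mutual (step {suc (suc _)} {suc (suc _)} j≡1+i) = reversed-mutual b-slot j≡1+i
  z-mutual (finish {suc zero} 1≡1+r) =
    Mutual-sym (short-mutual-last (cong (λ t → suc (t + b-slot)) (suc-injective 1≡1+r)))
  z-mutual (finish {suc (suc k)} k≡1+r) =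
    Mutual-sym (short-mutual (2 + q) (cong (_+ b-slot) (sym (backIndex≡0 k≡1+r))))
  z-mutual (start {suc _} ())
  z-mutual (step {zero} {zero} ())
  z-mutual (step {zero} {suc (suc _)} ())
  z-mutual (step {suc _} {zero} ())
  z-mutual (step {suc zero} {suc zero} ())
  z-mutual (step {suc (suc _)} {suc zero} ())
  z-mutual (finish {zero} ())

  z-mutual⇒edge : ∀ i j → _≢_ {A = V} (hz i) (hz j) → Mutual (shape (hz i)) (shape (hz j)) →
    E (hz i) (hz j)
  z-mutual⇒edge zero zero 0≢0 _ = ⊥-elim (0≢0 refl)
  z-mutual⇒edge zero (suc zero) _ _ = z-edge (step refl)
  z-mutual⇒edge zero (suc (suc k)) _ (_ , k→0) = ⊥-elim (m+1+n≢0 _ (short∋0 k→0))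
  z-mutual⇒edge (suc zero) (suc zero) 1≢1 _ = ⊥-elim (1≢1 refl)
  z-mutual⇒edge (suc zero) (suc (suc k)) _ (_ , k→1) =
    z-edge (step (cong (λ t → suc (suc t))
      (n≤0⇒n≡0 (≤-pred (≤-pred (toℕ≤-from-backIndex (suc (suc k)) r≤2+k))))))
    where
    r≤2+k : suc r ≤ 2 + backIndex (suc (suc k))
    r≤2+k = +-cancelʳ-≤ b-slot (suc r) _ (proj₂ (short∋even k→1))
  z-mutual⇒edge (suc (suc i)) (suc (suc j)) i≢j m
    with reversed-mutual⇒adjacent b-slot (λ i≡j → i≢j (cong hz i≡j)) m
  ... | inj₁ j≡1+i = z-edge (step j≡1+i)
  ... | inj₂ i≡1+j = HAdj-sym (z-edge (step i≡1+j))
  z-mutual⇒edge (suc zero) zero _ _ = HAdj-sym (z-edge (step refl))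
  z-mutual⇒edge (suc (suc k)) zero k≢0 m =
    HAdj-sym (z-mutual⇒edge zero (suc (suc k)) (λ 0≡k → k≢0 (sym 0≡k)) (Mutual-sym m))
  z-mutual⇒edge (suc (suc k)) (suc zero) k≢1 m =
    HAdj-sym (z-mutual⇒edge (suc zero) (suc (suc k)) (λ 1≡k → k≢1 (sym 1≡k)) (Mutual-sym m))

  rank : V → ℕ
  rank ha = 0
  rank hb = 1
  rank (hx _) = 2
  rank (hy _) = 3
  rank (hz _) = 4

  ordered-mutual⇒edge : ∀ u v → T (rank u ≤ᵇ rank v) → u ≢ v → Mutual (shape u) (shape v) → E u v
  ordered-mutual⇒edge ha ha _ a≢a _ = ⊥-elim (a≢a refl)
  ordered-mutual⇒edge ha hb _ _ (a→b , _) =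
    ⊥-elim (<⇒≱ (s≤s (s≤s (s≤s z≤n))) (proj₂ (short∋even a→b)))
  ordered-mutual⇒edge ha (hx zero) _ _ _ = x-edge (start refl)
  ordered-mutual⇒edge ha (hx (suc zero)) _ _ (a→x , _) =
    ⊥-elim (<⇒≱ (s≤s (s≤s z≤n)) (proj₂ (short∋odd {m = b-slot} a→x)))
  ordered-mutual⇒edge ha (hy i) _ _ (a→y , _) =
    y-edge (start (n≤0⇒n≡0 (≤-pred (≤-pred (proj₂ (short∋even a→y))))))
  ordered-mutual⇒edge ha (hz zero) _ _ _ = z-edge (start refl)
  ordered-mutual⇒edge ha (hz (suc zero)) _ _ (a→z , _) =
    ⊥-elim (<⇒≱ (≤-trans (s≤s (s≤s (s≤s z≤n))) (<⇒≤ b-slot<end-slot)) (proj₂ (short∋even a→z)))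
  ordered-mutual⇒edge ha (hz (suc (suc k))) _ _ (a→z , _) =
    ⊥-elim (<⇒≱ (s≤s (≤-trans (s≤s (s≤s z≤n)) (m≤n+m b-slot _))) (proj₂ (short∋even a→z)))
  ordered-mutual⇒edge hb hb _ b≢b _ = ⊥-elim (b≢b refl)
  ordered-mutual⇒edge hb (hx zero) _ _ (b→x , _) =
    ⊥-elim (<⇒≱ (s≤s z≤n) (proj₁ (short∋odd {k = 2 + q} {m = 0} b→x)))
  ordered-mutual⇒edge hb (hx (suc zero)) _ _ _ = HAdj-sym (x-edge (finish refl))
  ordered-mutual⇒edge hb (hy i) _ _ (b→y , _) =
    HAdj-sym (y-edge (finish
      (≤-antisym (toℕ≤pred[n] i) (≤-pred (≤-pred (proj₁ (short∋even b→y)))))))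
  ordered-mutual⇒edge hb (hz zero) _ _ (b→z , _) = ⊥-elim (1+n≢0 (short∋0 {2 + q} b→z))
  ordered-mutual⇒edge hb (hz (suc zero)) _ _ (b→z , _) =
    HAdj-sym (z-edge (finish (cong suc (sym (n≤0⇒n≡0
      (+-cancelʳ-≤ b-slot r 0 (≤-pred (proj₂ (short∋even b→z)))))))))
  ordered-mutual⇒edge hb (hz (suc (suc k))) _ _ (b→z , _) =
    HAdj-sym (z-edge (finish (backIndex≡0⁻¹ (n≤0⇒n≡0
      (+-cancelʳ-≤ b-slot _ 0 (≤-pred (proj₂ (short∋even b→z))))))))
  ordered-mutual⇒edge (hx zero) (hx zero) _ x≢x _ = ⊥-elim (x≢x refl)
  ordered-mutual⇒edge (hx zero) (hx (suc zero)) _ _ _ = x-edge (step refl)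
  ordered-mutual⇒edge (hx (suc zero)) (hx zero) _ _ _ = HAdj-sym (x-edge (step refl))
  ordered-mutual⇒edge (hx (suc zero)) (hx (suc zero)) _ x≢x _ = ⊥-elim (x≢x refl)
  ordered-mutual⇒edge (hx zero) (hy i) _ _ (_ , y→x) =
    ⊥-elim (<⇒≱ (s≤s z≤n) (proj₁ (short∋odd {m = 0} y→x)))
  ordered-mutual⇒edge (hx (suc zero)) (hy i) _ _ (_ , y→x) =
    ⊥-elim (<⇒≱ (s≤s (s≤s (s≤s (toℕ≤pred[n] i)))) (proj₂ (short∋odd y→x)))
  ordered-mutual⇒edge (hx _) (hz zero) _ _ ((() , _) , _)
  ordered-mutual⇒edge (hx _) (hz (suc zero)) _ _ ((_ , x→z) , _) =
    ⊥-elim (<⇒≱ b-slot<end-slot (2*m≤1+2*n⇒m≤n x→z))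
  ordered-mutual⇒edge (hx _) (hz (suc (suc k))) _ _ ((_ , x→z) , _) =
    ⊥-elim (<⇒≱ (s≤s (m≤n+m b-slot _)) (2*m≤1+2*n⇒m≤n x→z))
  ordered-mutual⇒edge (hy i) (hy j) _ i≢j m
    with short-mutual⇒adjacent (λ 1+i≡1+j → i≢j (cong hy (toℕ-injective (suc-injective 1+i≡1+j)))) m
  ... | inj₁ 2+i≡1+j = y-edge (step (sym (suc-injective 2+i≡1+j)))
  ... | inj₂ 2+j≡1+i = HAdj-sym (y-edge (step (sym (suc-injective 2+j≡1+i))))
  ordered-mutual⇒edge (hy i) (hz zero) _ _ (y→z , _) = ⊥-elim (1+n≢0 (short∋0 y→z))
  ordered-mutual⇒edge (hy i) (hz (suc zero)) _ _ (y→z , _) =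
    ⊥-elim (<⇒≱ b-slot<end-slot
      (≤-trans (proj₂ (short∋even y→z)) (s≤s (s≤s (s≤s (toℕ≤pred[n] i))))))
  ordered-mutual⇒edge (hy i) (hz (suc (suc k))) _ _ (y→z , _) =
    ⊥-elim (<⇒≱ (s≤s (m≤n+m b-slot _))
      (≤-trans (proj₂ (short∋even y→z)) (s≤s (s≤s (s≤s (toℕ≤pred[n] i))))))
  ordered-mutual⇒edge (hz i) (hz j) _ i≢j m = z-mutual⇒edge i j i≢j m
  ordered-mutual⇒edge hb ha () _ _
  ordered-mutual⇒edge (hx _) ha () _ _
  ordered-mutual⇒edge (hx _) hb () _ _
  ordered-mutual⇒edge (hy _) ha () _ _
  ordered-mutual⇒edge (hy _) hb () _ _
  ordered-mutual⇒edge (hy _) (hx _) () _ _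
  ordered-mutual⇒edge (hz _) ha () _ _
  ordered-mutual⇒edge (hz _) hb () _ _
  ordered-mutual⇒edge (hz _) (hx _) () _ _
  ordered-mutual⇒edge (hz _) (hy _) () _ _

  realization : And1Realizationℕ E
  realization = record
    { shape = shape
    ; pt∈shape = pt∈shape
    ; edge⇒mutual = HAdj-rec Mutual-sym x-mutual y-mutual z-mutual
    ; mutual⇒edge = mutual⇒edge-by-rank shape rank HAdj-sym ordered-mutual⇒edge
    }

H₂∈And1 : ∀ ly lz → 2 ≤ ly → 2 ≤ lz → InAnd1 (HAdj 2 ly lz)
H₂∈And1 (suc (suc q)) (suc (suc r)) (s≤s (s≤s z≤n)) (s≤s (s≤s z≤n)) =
  And1Realizationℕ⇒InAnd1 (H₂.realization q r)

H₃∈And1 : ∀ ly lz → 2 ≤ ly → 3 ≤ lz → InAnd1 (HAdj 3 ly lz)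
H₃∈And1 (suc (suc q)) (suc (suc (suc r))) (s≤s (s≤s z≤n)) (s≤s (s≤s (s≤s z≤n))) =
  And1Realizationℕ⇒InAnd1 (H₃.realization q r)

lemma6 : ((ly lz : ℕ) → 2 ≤ ly → 2 ≤ lz → InAnd1 (HAdj 2 ly lz))
       × ((ly lz : ℕ) → 3 ≤ ly → 3 ≤ lz → InAnd1 (HAdj 3 ly lz))
lemma6 = H₂∈And1 , λ ly lz 3≤ly → H₃∈And1 ly lz (≤-trans (n≤1+n 2) 3≤ly)
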